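{- Let $p$ be a prime and $z\in\mathbb{Z}_p$. Then the limit $\mu_p(z,1)=\lim_{n\to\infty}F_n(z,1)$ exists and equals $\frac{1}{p+1}$.
   Context: The Calkin--Wilf tree is the infinite rooted binary tree generated from the root $\frac11$ by giving each vertex labelled $\frac ab$ (reduced) a left child $\frac{a}{a+b}$ and a right child $\frac{a+b}{b}$; its $n$th generation $\mathcal{CW}^{(n)}$ is the multiset of the $2^{n-1}$ labels at distance $n-1$ from the root. For a prime $p$, $z\in\mathbb{Q}_p$ and $\nu\in\mathbb{Z}$, put $F_n(z,\nu)=2^{1-n}\#\{\frac ab\in\mathcal{CW}^{(n)}:\ \mathrm{ord}_p(\frac ab-z)\ge\nu\}$, where $\mathrm{ord}_p$ is the $p$-adic valuation (with $\mathrm{ord}_p(0)=+\infty$), and $\mu_p(z,\nu)=\lim_{n\to\infty}F_n(z,\nu)$. -}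

module Defs where

open import Data.Nat using (ℕ; zero; suc; _+_; _*_; _^_; _<_; _%_; NonZero)
open import Data.Nat.Properties using (m^n≢0)
open import Data.Nat.Divisibility using (_∣?_)
open import Data.Integer using (ℤ; +_; _-_; ∣_∣)
open import Data.Bool using (Bool; _∧_; not; if_then_else_)
open import Data.List using (List; []; _∷_; concatMap; length; filterᵇ)
open import Data.Product using (_×_; _,_)
open import Relation.Nullary.Decidable using (⌊_⌋)
open import Relation.Binary.PropositionalEquality using (_≡_)
open import Data.Rational using (ℚ) renaming (_/_ to _/ℚ_)

-- p-adic integers Z_p as compatible systems of residues:
-- z k ∈ {0,…,p^k - 1} and z (k+1) ≡ z k (mod p^k).
record ℤ[_] (p : ℕ) : Set where
  field
    res    : ℕ → ℕ
    bound  : ∀ k → res k < p ^ k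
    compat : ∀ k → .{{_ : NonZero (p ^ k)}} → res (suc k) % (p ^ k) ≡ res k
open ℤ[_] public

-- Calkin–Wilf generations; cw n = CW^(n+1) (multiset of 2^n labels),
-- a label a/b is stored as the pair (a , b) (always reduced).
cw : ℕ → List (ℕ × ℕ)
cw zero    = (1 , 1) ∷ []
cw (suc n) = concatMap (λ { (a , b) → (a , a + b) ∷ (a + b , b) ∷ [] }) (cw n)

-- For reduced a/b, z ∈ Z_p and ν ≥ 0:
-- ord_p(a/b - z) ≥ ν  ⇔  p ∤ b  and  p^ν ∣ a - z_ν b  (z_ν = z mod p^ν).
ordGe : (p : ℕ) → ℤ[ p ] → ℕ → ℕ × ℕ → Bool
ordGe p z ν (a , b) =
  not ⌊ p ∣? b ⌋ ∧ ⌊ (p ^ ν) ∣? ∣ (+ a) - (+ (res z ν * b)) ∣ ⌋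

-- F p z ν n = F_{n+1}(z, ν) = 2^{-n} #{ a/b ∈ CW^(n+1) : ord_p(a/b - z) ≥ ν }
F : (p : ℕ) → ℤ[ p ] → ℕ → ℕ → ℚ
F p z ν n = _/ℚ_ (+ length (filterᵇ (ordGe p z ν) (cw n))) (2 ^ n) {{m^n≢0 2 n}}

-- Reduce each label a/b of the Calkin–Wilf tree to its residue pair (a mod p, b mod p).
-- A generation then becomes 2^n points of the punctured plane (Z/p)² ∖ {0}, and the number
-- count n t of labels with residue pair t obeys count (n+1) t = count n (L⁻¹ t) + count n (R⁻¹ t)
-- for the shears L(u,v) = (u, u+v) and R(u,v) = (u+v, v). Since p is prime, every punctured
-- point is an ancestor of every other one after exactly K = 6p steps, so each count after K
-- more steps is the total 2^n plus a sum of counts over the repeated ancestors; this Doeblin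
-- argument shrinks the spread max − min of count by the factor (2^K − (p² − 1)) / 2^K every K
-- steps. Hence count tends to 2^n / (p² − 1) on each punctured point. A label satisfies
-- ord_p(a/b − z) ≥ 1 exactly when its residue pair lies on the line u = z v, v ≠ 0, which has
-- p − 1 points, giving the limit (p − 1) / (p² − 1) = 1 / (p + 1).
module Submission where

open import Data.Nat using (ℕ; NonZero)
open import Data.Nat.Primality using (Prime)

module FiniteSum where

  open import Data.Nat
  open import Data.Nat.Properties
  open import Relation.Binary.PropositionalEquality
  open import Relation.Nullary using (yes; no)
  open import Data.Empty using (⊥-elim)
  open import Function using (_∘_)
  open import Algebra.Properties.CommutativeSemigroup +-commutativeSemigroup
    using () renaming (interchange to +-interchange)
  open import Data.Nat.ListAction using (sum)
  open import Data.Nat.ListAction.Properties using (sum-++)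
  open import Data.List using (List; []; _∷_; _++_; map; length; filterᵇ)
  open import Data.List.Properties using (map-++)
  open import Data.Bool using (Bool; true; false; if_then_else_)

  sum< : ℕ → (ℕ → ℕ) → ℕ
  sum< zero    f = 0
  sum< (suc n) f = sum< n f + f n

  infix 8 sum<
  syntax sum< n (λ i → e) = ∑[ i < n ] e

  ∑-cong : ∀ n {f g : ℕ → ℕ} → (∀ i → i < n → f i ≡ g i) → ∑[ i < n ] f i ≡ ∑[ i < n ] g i
  ∑-cong zero    eq = refl
  ∑-cong (suc n) eq = cong₂ _+_ (∑-cong n (λ i i<n → eq i (m<n⇒m<1+n i<n))) (eq n ≤-refl)

  ∑-mono-≤ : ∀ n {f g : ℕ → ℕ} → (∀ i → i < n → f i ≤ g i) → ∑[ i < n ] f i ≤ ∑[ i < n ] g i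
  ∑-mono-≤ zero    le = z≤n
  ∑-mono-≤ (suc n) le = +-mono-≤ (∑-mono-≤ n (λ i i<n → le i (m<n⇒m<1+n i<n))) (le n ≤-refl)

  ∑-distrib-+ : ∀ n (f g : ℕ → ℕ) → ∑[ i < n ] (f i + g i) ≡ ∑[ i < n ] f i + ∑[ i < n ] g i
  ∑-distrib-+ zero    f g = refl
  ∑-distrib-+ (suc n) f g rewrite ∑-distrib-+ n f g = +-interchange (sum< n f) (sum< n g) (f n) (g n)

  ∑-*ˡ : ∀ n k (f : ℕ → ℕ) → ∑[ i < n ] (k * f i) ≡ k * ∑[ i < n ] f i
  ∑-*ˡ zero    k f = sym (*-zeroʳ k)
  ∑-*ˡ (suc n) k f rewrite ∑-*ˡ n k f = sym (*-distribˡ-+ k (sum< n f) (f n))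

  ∑-*ʳ : ∀ n k (f : ℕ → ℕ) → ∑[ i < n ] (f i * k) ≡ ∑[ i < n ] f i * k
  ∑-*ʳ n k f = trans (∑-cong n (λ i _ → *-comm (f i) k)) (trans (∑-*ˡ n k f) (*-comm k (sum< n f)))

  ∑-const : ∀ n k → ∑[ i < n ] k ≡ n * k
  ∑-const zero    k = refl
  ∑-const (suc n) k rewrite ∑-const n k = +-comm (n * k) k

  ∑-zero : ∀ n {f : ℕ → ℕ} → (∀ i → i < n → f i ≡ 0) → ∑[ i < n ] f i ≡ 0
  ∑-zero n eq = trans (∑-cong n eq) (trans (∑-const n 0) (*-zeroʳ n))

  ∑-comm : ∀ m n (f : ℕ → ℕ → ℕ) → ∑[ i < m ] ∑[ j < n ] f i j ≡ ∑[ j < n ] ∑[ i < m ] f i j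
  ∑-comm zero    n f = sym (∑-zero n (λ _ _ → refl))
  ∑-comm (suc m) n f rewrite ∑-comm m n f = sym (∑-distrib-+ n (λ j → ∑[ i < m ] f i j) (λ j → f m j))

  ∑-head : ∀ n (f : ℕ → ℕ) → ∑[ i < suc n ] f i ≡ f 0 + ∑[ i < n ] f (suc i)
  ∑-head zero    f = +-comm 0 (f 0)
  ∑-head (suc n) f rewrite ∑-head n f = +-assoc (f 0) (∑[ i < n ] f (suc i)) (f (suc n))

  δ : ℕ → ℕ → ℕ
  δ i j with i ≟ j
  ... | yes _ = 1
  ... | no  _ = 0

  δ-refl : ∀ i → δ i i ≡ 1
  δ-refl i with i ≟ i
  ... | yes _ = refl
  ... | no i≢i = ⊥-elim (i≢i refl)

  δ-≢ : ∀ {i j} → i ≢ j → δ i j ≡ 0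
  δ-≢ {i} {j} i≢j with i ≟ j
  ... | yes i≡j = ⊥-elim (i≢j i≡j)
  ... | no  _   = refl

  δ≤1 : ∀ i j → δ i j ≤ 1
  δ≤1 i j with i ≟ j
  ... | yes _ = ≤-refl
  ... | no  _ = z≤n

  δ-cong-⇔ : ∀ {a b c d} → (a ≡ b → c ≡ d) → (c ≡ d → a ≡ b) → δ a b ≡ δ c d
  δ-cong-⇔ {a} {b} {c} {d} to from with a ≟ b | c ≟ d
  ... | yes _   | yes _   = refl
  ... | yes a≡b | no  c≢d = ⊥-elim (c≢d (to a≡b))
  ... | no  a≢b | yes c≡d = ⊥-elim (a≢b (from c≡d))
  ... | no  _   | no  _   = refl

  ∑-*-δ : ∀ n b (f : ℕ → ℕ) → b < n → ∑[ i < n ] (f i * δ i b) ≡ f b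
  ∑-*-δ (suc n) b f b<1+n with b ≟ n
  ... | yes refl = begin
      ∑[ i < n ] (f i * δ i b) + f b * δ b b
        ≡⟨ cong₂ _+_ (∑-zero n (λ i i<n → trans (cong (f i *_) (δ-≢ (λ i≡b → <-irrefl i≡b i<n))) (*-zeroʳ (f i))))
                     (cong (f b *_) (δ-refl b)) ⟩
      0 + f b * 1 ≡⟨ *-identityʳ (f b) ⟩
      f b ∎
    where open ≡-Reasoning
  ... | no b≢n = begin
      ∑[ i < n ] (f i * δ i b) + f n * δ n b
        ≡⟨ cong₂ _+_ (∑-*-δ n b f (≤∧≢⇒< (≤-pred b<1+n) b≢n)) (cong (f n *_) (δ-≢ (b≢n ∘ sym))) ⟩
      f b + f n * 0 ≡⟨ cong (f b +_) (*-zeroʳ (f n)) ⟩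
      f b + 0 ≡⟨ +-identityʳ (f b) ⟩
      f b ∎
    where open ≡-Reasoning

  ∑-δ : ∀ n b → b < n → ∑[ i < n ] δ i b ≡ 1
  ∑-δ n b b<n = trans (∑-cong n (λ i _ → sym (*-identityˡ (δ i b)))) (∑-*-δ n b (λ _ → 1) b<n)

  ∑ₗ : ∀ {A : Set} → (A → ℕ) → List A → ℕ
  ∑ₗ f xs = sum (map f xs)

  ∑ₗ-++ : ∀ {A : Set} (f : A → ℕ) xs ys → ∑ₗ f (xs ++ ys) ≡ ∑ₗ f xs + ∑ₗ f ys
  ∑ₗ-++ f xs ys = trans (cong sum (map-++ f xs ys)) (sum-++ (map f xs) (map f ys))

  ∑ₗ-cong : ∀ {A : Set} {f g : A → ℕ} xs → (∀ x → f x ≡ g x) → ∑ₗ f xs ≡ ∑ₗ g xs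
  ∑ₗ-cong []       eq = refl
  ∑ₗ-cong (x ∷ xs) eq = cong₂ _+_ (eq x) (∑ₗ-cong xs eq)

  𝟙ᵇ : Bool → ℕ
  𝟙ᵇ b = if b then 1 else 0

  length-filterᵇ : ∀ {A : Set} (P : A → Bool) xs → length (filterᵇ P xs) ≡ ∑ₗ (𝟙ᵇ ∘ P) xs
  length-filterᵇ P []       = refl
  length-filterᵇ P (x ∷ xs) with P x
  ... | true  = cong suc (length-filterᵇ P xs)
  ... | false = length-filterᵇ P xs

module Residues (q : ℕ) .{{_ : NonZero q}} where

  open import Data.Nat
  open import Data.Nat.Properties
  open import Data.Nat.DivMod
  open import Data.Nat.Divisibility using (_∣_; m%n≡0⇒n∣m)
  import Data.Integer as ℤ
  open import Data.Integer.Properties using ([+m]-[+n]≡m⊖n; ∣⊖∣-≤; ∣m⊖n∣≡∣n⊖m∣)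
  open import Data.Sum using (inj₁; inj₂)
  open import Relation.Binary.PropositionalEquality
  open FiniteSum

  ∑-rotate₁ : ∀ n .{{_ : NonZero n}} (g : ℕ → ℕ) → ∑[ v < n ] g ((v + 1) % n) ≡ ∑[ v < n ] g v
  ∑-rotate₁ (suc m) g = begin
      ∑[ v < m ] g ((v + 1) % suc m) + g ((m + 1) % suc m)
        ≡⟨ cong₂ _+_ (∑-cong m (λ v v<m → cong g (m<n⇒m%n≡m (subst (_< suc m) (+-comm 1 v) (s≤s v<m)))))
                     (cong g (trans (cong (_% suc m) (+-comm m 1)) (n%n≡0 (suc m)))) ⟩
      ∑[ v < m ] g (v + 1) + g 0       ≡⟨ +-comm _ (g 0) ⟩
      g 0 + ∑[ v < m ] g (v + 1)       ≡⟨ cong (g 0 +_) (∑-cong m (λ v _ → cong g (+-comm v 1))) ⟩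
      g 0 + ∑[ v < m ] g (suc v)       ≡⟨ ∑-head m g ⟨
      ∑[ v < suc m ] g v               ∎
    where open ≡-Reasoning

  infix 4 _≡ₘ_
  _≡ₘ_ : ℕ → ℕ → Set
  a ≡ₘ b = a % q ≡ b % q

  0%q≡0 : 0 % q ≡ 0
  0%q≡0 = m<n⇒m%n≡m (>-nonZero⁻¹ q)

  %-≡ₘ : ∀ a → a % q ≡ₘ a
  %-≡ₘ a = m%n%n≡m%n a q

  +-cong-≡ₘ : ∀ {a b c d} → a ≡ₘ b → c ≡ₘ d → a + c ≡ₘ b + d
  +-cong-≡ₘ {a} {b} {c} {d} a≡b c≡d =
    trans (%-distribˡ-+ a c q) (trans (cong₂ (λ x y → (x + y) % q) a≡b c≡d) (sym (%-distribˡ-+ b d q)))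

  *-cong-≡ₘ : ∀ {a b c d} → a ≡ₘ b → c ≡ₘ d → a * c ≡ₘ b * d
  *-cong-≡ₘ {a} {b} {c} {d} a≡b c≡d =
    trans (%-distribˡ-* a c q) (trans (cong₂ (λ x y → (x * y) % q) a≡b c≡d) (sym (%-distribˡ-* b d q)))

  +-congˡ-≡ₘ : ∀ a {c d} → c ≡ₘ d → a + c ≡ₘ a + d
  +-congˡ-≡ₘ a = +-cong-≡ₘ {a} {a} refl

  ∸%+≡ₘ0 : ∀ a → (q ∸ a % q) + a ≡ₘ 0
  ∸%+≡ₘ0 a = trans (+-congˡ-≡ₘ (q ∸ a % q) (sym (%-≡ₘ a)))
                   (trans (cong (_% q) (m∸n+n≡m (<⇒≤ (m%n<n a q)))) (trans (n%n≡0 q) (sym 0%q≡0)))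

  [v+q]%q≡v : ∀ {v} → v < q → (v + q) % q ≡ v
  [v+q]%q≡v {v} v<q = trans ([m+n]%n≡m%n v q) (m<n⇒m%n≡m v<q)

  ∑-rotate : ∀ k (g : ℕ → ℕ) → ∑[ v < q ] g ((v + k) % q) ≡ ∑[ v < q ] g v
  ∑-rotate zero    g = ∑-cong q (λ v v<q → cong g (trans (cong (_% q) (+-identityʳ v)) (m<n⇒m%n≡m v<q)))
  ∑-rotate (suc k) g = begin
      ∑[ v < q ] g ((v + suc k) % q)
        ≡⟨ ∑-cong q (λ v _ → cong g (trans (cong (_% q) (sym (+-assoc v 1 k)))
                                           (+-cong-≡ₘ {v + 1} {(v + 1) % q} {k} (sym (%-≡ₘ (v + 1))) refl))) ⟩
      ∑[ v < q ] g ((((v + 1) % q) + k) % q)   ≡⟨ ∑-rotate₁ q (λ w → g ((w + k) % q)) ⟩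
      ∑[ w < q ] g ((w + k) % q)               ≡⟨ ∑-rotate k g ⟩
      ∑[ v < q ] g v                           ∎
    where open ≡-Reasoning

  ≤∧∣∸⇒≡ₘ : ∀ {m n} → m ≤ n → q ∣ n ∸ m → m ≡ₘ n
  ≤∧∣∸⇒≡ₘ {m} m≤n q∣n∸m = sym (trans (cong (_% q) (sym (m+[n∸m]≡n m≤n))) (%-remove-+ʳ m q∣n∸m))

  ≤∧≡ₘ⇒∣∸ : ∀ {m n} → m ≤ n → m ≡ₘ n → q ∣ n ∸ m
  ≤∧≡ₘ⇒∣∸ {m} {n} m≤n m≡n = m%n≡0⇒n∣m (n ∸ m) q (begin
      (n ∸ m) % q                         ≡⟨ cong (_% q) (+-identityʳ (n ∸ m)) ⟨
      (n ∸ m + 0) % q                     ≡⟨ +-congˡ-≡ₘ (n ∸ m) (∸%+≡ₘ0 m) ⟨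
      (n ∸ m + ((q ∸ m % q) + m)) % q     ≡⟨ cong (_% q) (trans (cong (n ∸ m +_) (+-comm _ m)) (sym (+-assoc (n ∸ m) m _))) ⟩
      (n ∸ m + m + (q ∸ m % q)) % q       ≡⟨ cong (λ x → (x + (q ∸ m % q)) % q) (m∸n+n≡m m≤n) ⟩
      (n + (q ∸ m % q)) % q               ≡⟨ +-cong-≡ₘ {n} {m} (sym m≡n) refl ⟩
      (m + (q ∸ m % q)) % q               ≡⟨ cong (_% q) (+-comm m _) ⟩
      ((q ∸ m % q) + m) % q               ≡⟨ ∸%+≡ₘ0 m ⟩
      0 % q                               ≡⟨ 0%q≡0 ⟩
      0                                   ∎)
    where open ≡-Reasoning

  ∣∣-∣⇒≡ₘ : ∀ m n → q ∣ ℤ.∣ ℤ.+ m ℤ.- ℤ.+ n ∣ → m ≡ₘ n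
  ∣∣-∣⇒≡ₘ m n q∣ rewrite [+m]-[+n]≡m⊖n m n with ≤-total m n
  ... | inj₁ m≤n rewrite ∣⊖∣-≤ m≤n = ≤∧∣∸⇒≡ₘ m≤n q∣
  ... | inj₂ n≤m rewrite ∣m⊖n∣≡∣n⊖m∣ m n | ∣⊖∣-≤ n≤m = sym (≤∧∣∸⇒≡ₘ n≤m q∣)

  ≡ₘ⇒∣∣-∣ : ∀ m n → m ≡ₘ n → q ∣ ℤ.∣ ℤ.+ m ℤ.- ℤ.+ n ∣
  ≡ₘ⇒∣∣-∣ m n m≡n rewrite [+m]-[+n]≡m⊖n m n with ≤-total m n
  ... | inj₁ m≤n rewrite ∣⊖∣-≤ m≤n = ≤∧≡ₘ⇒∣∸ m≤n m≡n
  ... | inj₂ n≤m rewrite ∣m⊖n∣≡∣n⊖m∣ m n | ∣⊖∣-≤ n≤m = ≤∧≡ₘ⇒∣∸ n≤m (sym m≡n)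

module Walk (p : ℕ) .{{_ : NonZero p}} where

  open import Data.Nat
  open import Data.Nat.Properties
  open import Data.Nat.DivMod
  open import Data.Product using (_×_; _,_; proj₁; proj₂)
  open import Data.List using (List; []; _∷_; _++_)
  open import Data.List.Relation.Unary.All as All using (All; []; _∷_)
  open import Data.List.Relation.Unary.All.Properties using (++⁺)
  open import Data.List.Relation.Unary.Any using (here; there)
  open import Data.List.Membership.Propositional using (_∈_)
  open import Relation.Binary.PropositionalEquality
  open import Relation.Nullary using (yes; no; ¬_)
  open import Data.Empty using (⊥-elim)
  open import Function using (_∘_; id)
  open FiniteSum
  open Residues p

  Point : Set
  Point = ℕ × ℕ

  δ² : Point → Point → ℕ
  δ² (u , v) (a , b) = δ u a * δ v b

  δ²≤1 : ∀ s t → δ² s t ≤ 1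
  δ²≤1 (u , v) (a , b) = *-mono-≤ (δ≤1 u a) (δ≤1 v b)

  δ²-refl : ∀ t → δ² t t ≡ 1
  δ²-refl (u , v) = cong₂ _*_ (δ-refl u) (δ-refl v)

  NonOrigin : Point → Set
  NonOrigin (u , v) = ¬ (u ≡ 0 × v ≡ 0)

  data OriginView : Point → Set where
    origin    : OriginView (0 , 0)
    nonOrigin : ∀ {t} → NonOrigin t → OriginView t

  originView : ∀ t → OriginView t
  originView (u , v) with u ≟ 0 | v ≟ 0
  ... | yes refl | yes refl = origin
  ... | yes _    | no v≢0   = nonOrigin (λ (_ , v≡0) → v≢0 v≡0)
  ... | no u≢0   | _        = nonOrigin (λ (u≡0 , _) → u≢0 u≡0)

  δ²-comm : ∀ s t → δ² s t ≡ δ² t s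
  δ²-comm (u , v) (a , b) = cong₂ _*_ (δ-cong-⇔ {u} {a} sym sym) (δ-cong-⇔ {v} {b} sym sym)

  δ²-origin : ∀ {t} → NonOrigin t → δ² t (0 , 0) ≡ 0
  δ²-origin {u , v} t≢0 with 0 ≟ u | 0 ≟ v
  ... | yes 0≡u | yes 0≡v = ⊥-elim (t≢0 (sym 0≡u , sym 0≡v))
  ... | yes _   | no 0≢v  = trans (cong (δ u 0 *_) (δ-≢ (0≢v ∘ sym))) (*-zeroʳ (δ u 0))
  ... | no 0≢u  | _       = cong (_* δ v 0) (δ-≢ (0≢u ∘ sym))

  𝟙-nonOrigin : Point → ℕ
  𝟙-nonOrigin t = 1 ∸ δ² t (0 , 0)

  𝟙-nonOrigin-origin : 𝟙-nonOrigin (0 , 0) ≡ 0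
  𝟙-nonOrigin-origin = cong (1 ∸_) (δ²-refl (0 , 0))

  -- Z/p × Z/p is represented by the pairs of canonical residues
  InGrid : Point → Set
  InGrid (u , v) = u < p × v < p

  Punctured : Point → Set
  Punctured t = InGrid t × NonOrigin t

  ∑² : (Point → ℕ) → ℕ
  ∑² f = ∑[ u < p ] ∑[ v < p ] f (u , v)

  ∑²-cong : ∀ {f g : Point → ℕ} → (∀ t → InGrid t → f t ≡ g t) → ∑² f ≡ ∑² g
  ∑²-cong eq = ∑-cong p (λ u u<p → ∑-cong p (λ v v<p → eq (u , v) (u<p , v<p)))

  ∑²-mono-≤ : ∀ {f g : Point → ℕ} → (∀ t → InGrid t → f t ≤ g t) → ∑² f ≤ ∑² g
  ∑²-mono-≤ le = ∑-mono-≤ p (λ u u<p → ∑-mono-≤ p (λ v v<p → le (u , v) (u<p , v<p)))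

  ∑²-distrib-+ : ∀ (f g : Point → ℕ) → ∑² (λ t → f t + g t) ≡ ∑² f + ∑² g
  ∑²-distrib-+ f g = trans (∑-cong p (λ u _ → ∑-distrib-+ p (λ v → f (u , v)) (λ v → g (u , v))))
                           (∑-distrib-+ p (λ u → ∑[ v < p ] f (u , v)) (λ u → ∑[ v < p ] g (u , v)))

  ∑²-*ˡ : ∀ k (f : Point → ℕ) → ∑² (λ t → k * f t) ≡ k * ∑² f
  ∑²-*ˡ k f = trans (∑-cong p (λ u _ → ∑-*ˡ p k (λ v → f (u , v)))) (∑-*ˡ p k (λ u → ∑[ v < p ] f (u , v)))

  ∑²-*ʳ : ∀ k (f : Point → ℕ) → ∑² (λ t → f t * k) ≡ ∑² f * k
  ∑²-*ʳ k f = trans (∑²-cong (λ t _ → *-comm (f t) k)) (trans (∑²-*ˡ k f) (*-comm k (∑² f)))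

  ∑²-comm : ∀ (f : Point → ℕ) → ∑² f ≡ ∑[ v < p ] ∑[ u < p ] f (u , v)
  ∑²-comm f = ∑-comm p p (λ u v → f (u , v))

  ∑²-*-δ² : ∀ {s} → InGrid s → ∀ (f : Point → ℕ) → ∑² (λ t → f t * δ² t s) ≡ f s
  ∑²-*-δ² {a , b} (a<p , b<p) f = begin
      ∑[ u < p ] ∑[ v < p ] (f (u , v) * (δ u a * δ v b))
        ≡⟨ ∑-cong p (λ u _ → ∑-cong p (λ v _ → *-comm-middle (f (u , v)) (δ u a) (δ v b))) ⟩
      ∑[ u < p ] ∑[ v < p ] (f (u , v) * δ v b * δ u a)
        ≡⟨ ∑-cong p (λ u _ → ∑-*ʳ p (δ u a) (λ v → f (u , v) * δ v b)) ⟩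
      ∑[ u < p ] ((∑[ v < p ] (f (u , v) * δ v b)) * δ u a)
        ≡⟨ ∑-cong p (λ u _ → cong (_* δ u a) (∑-*-δ p b (λ v → f (u , v)) b<p)) ⟩
      ∑[ u < p ] (f (u , b) * δ u a)
        ≡⟨ ∑-*-δ p a (λ u → f (u , b)) a<p ⟩
      f (a , b) ∎
    where
    open ≡-Reasoning
    *-comm-middle : ∀ x y z → x * (y * z) ≡ x * z * y
    *-comm-middle x y z = trans (cong (x *_) (*-comm y z)) (sym (*-assoc x z y))

  ∑²-δ² : ∀ {s} → InGrid s → ∑² (λ t → δ² t s) ≡ 1
  ∑²-δ² {s} s∈grid = trans (∑²-cong (λ t _ → sym (*-identityˡ (δ² t s)))) (∑²-*-δ² s∈grid (λ _ → 1))

  ∑²-1 : ∑² (λ _ → 1) ≡ p * p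
  ∑²-1 = trans (∑-cong p (λ u _ → trans (∑-const p 1) (*-identityʳ p))) (∑-const p p)

  ∑²-nonOrigin : ∑² 𝟙-nonOrigin + 1 ≡ p * p
  ∑²-nonOrigin = begin
      ∑² 𝟙-nonOrigin + 1
        ≡⟨ cong (∑² 𝟙-nonOrigin +_) (∑²-δ² (0<p , 0<p)) ⟨
      ∑² 𝟙-nonOrigin + ∑² (λ t → δ² t (0 , 0))
        ≡⟨ ∑²-distrib-+ 𝟙-nonOrigin (λ t → δ² t (0 , 0)) ⟨
      ∑² (λ t → (1 ∸ δ² t (0 , 0)) + δ² t (0 , 0))
        ≡⟨ ∑²-cong (λ t _ → m∸n+n≡m (δ²≤1 t (0 , 0))) ⟩
      ∑² (λ _ → 1)
        ≡⟨ ∑²-1 ⟩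
      p * p ∎
    where
    open ≡-Reasoning
    0<p = >-nonZero⁻¹ p

  -- The Calkin–Wilf children (a , a + b) and (a + b , b) of a residue pair
  -- are undone by these two maps.
  leftParent : Point → Point
  leftParent (u , v) = (u , (v + (p ∸ u)) % p)

  rightParent : Point → Point
  rightParent (u , v) = ((u + (p ∸ v)) % p , v)

  ∑²-leftParent : ∀ (f : Point → ℕ) → ∑² (λ t → f (leftParent t)) ≡ ∑² f
  ∑²-leftParent f = ∑-cong p (λ u _ → ∑-rotate (p ∸ u) (λ w → f (u , w)))

  ∑²-rightParent : ∀ (f : Point → ℕ) → ∑² (λ t → f (rightParent t)) ≡ ∑² f
  ∑²-rightParent f = trans (∑²-comm (λ t → f (rightParent t)))
    (trans (∑-cong p (λ v _ → ∑-rotate (p ∸ v) (λ w → f (w , v)))) (sym (∑²-comm f)))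

  leftParent-inGrid : ∀ {t} → InGrid t → InGrid (leftParent t)
  leftParent-inGrid {u , v} (u<p , _) = u<p , m%n<n _ p

  rightParent-inGrid : ∀ {t} → InGrid t → InGrid (rightParent t)
  rightParent-inGrid {u , v} (_ , v<p) = m%n<n _ p , v<p

  leftParent-punctured : ∀ {t} → Punctured t → Punctured (leftParent t)
  leftParent-punctured {u , v} (t∈grid@(_ , v<p) , t≢0) =
    leftParent-inGrid t∈grid , λ (u≡0 , v′≡0) →
      t≢0 (u≡0 , trans (sym ([v+q]%q≡v v<p)) (subst (λ x → (v + (p ∸ x)) % p ≡ 0) u≡0 v′≡0))

  rightParent-punctured : ∀ {t} → Punctured t → Punctured (rightParent t)
  rightParent-punctured {u , v} (t∈grid@(u<p , _) , t≢0) =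
    rightParent-inGrid t∈grid , λ (u′≡0 , v≡0) →
      t≢0 (trans (sym ([v+q]%q≡v u<p)) (subst (λ x → (u + (p ∸ x)) % p ≡ 0) v≡0 u′≡0) , v≡0)

  pull : (Point → ℕ) → Point → ℕ
  pull f t = f (leftParent t) + f (rightParent t)

  ∑²-pull : ∀ (f : Point → ℕ) → ∑² (pull f) ≡ ∑² f + ∑² f
  ∑²-pull f = trans (∑²-distrib-+ (f ∘ leftParent) (f ∘ rightParent)) (cong₂ _+_ (∑²-leftParent f) (∑²-rightParent f))

  -- count n t is the number of labels of cw n whose numerator and denominator reduce to t
  -- (residueCount-cw below)
  count : ℕ → Point → ℕ
  count zero    t = δ² t (1 % p , 1 % p)
  count (suc n) t = pull (count n) t

  ∑²-count : ∀ n → ∑² (count n) ≡ 2 ^ n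
  ∑²-count zero    = ∑²-δ² (m%n<n 1 p , m%n<n 1 p)
  ∑²-count (suc n) = trans (∑²-pull (count n)) (trans (cong (λ x → x + x) (∑²-count n)) (cong (2 ^ n +_) (sym (+-identityʳ (2 ^ n)))))

  count≤2^n : ∀ n t → count n t ≤ 2 ^ n
  count≤2^n zero    t = δ²≤1 t _
  count≤2^n (suc n) t = subst (count n (leftParent t) + count n (rightParent t) ≤_) (cong (2 ^ n +_) (sym (+-identityʳ (2 ^ n))))
                              (+-mono-≤ (count≤2^n n (leftParent t)) (count≤2^n n (rightParent t)))

  count-origin : 1 < p → ∀ n → count n (0 , 0) ≡ 0
  count-origin 1<p zero    = cong (_* δ 0 (1 % p)) (δ-≢ (λ 0≡1%p → 0≢1+n (trans 0≡1%p (m<n⇒m%n≡m 1<p))))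
  count-origin 1<p (suc n) = cong₂ _+_ (trans (cong (count n) (cong (0 ,_) (n%n≡0 p))) (count-origin 1<p n))
                                       (trans (cong (count n) (cong (_, 0) (n%n≡0 p))) (count-origin 1<p n))

  ancestors : ℕ → Point → List Point
  ancestors zero    t = t ∷ []
  ancestors (suc k) t = ancestors k (leftParent t) ++ ancestors k (rightParent t)

  count-+ : ∀ k n t → count (k + n) t ≡ ∑ₗ (count n) (ancestors k t)
  count-+ zero    n t = sym (+-identityʳ (count n t))
  count-+ (suc k) n t = trans (cong₂ _+_ (count-+ k n (leftParent t)) (count-+ k n (rightParent t)))
                              (sym (∑ₗ-++ (count n) (ancestors k (leftParent t)) (ancestors k (rightParent t))))

  ancestors-punctured : ∀ k {t} → Punctured t → All Punctured (ancestors k t)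
  ancestors-punctured zero    t∈ = t∈ ∷ []
  ancestors-punctured (suc k) t∈ = ++⁺ (ancestors-punctured k (leftParent-punctured t∈)) (ancestors-punctured k (rightParent-punctured t∈))

  ∑ₗ-1-ancestors : ∀ k t → ∑ₗ (λ _ → 1) (ancestors k t) ≡ 2 ^ k
  ∑ₗ-1-ancestors zero    t = refl
  ∑ₗ-1-ancestors (suc k) t = trans (∑ₗ-++ (λ _ → 1) (ancestors k (leftParent t)) (ancestors k (rightParent t)))
    (trans (cong₂ _+_ (∑ₗ-1-ancestors k (leftParent t)) (∑ₗ-1-ancestors k (rightParent t))) (cong (2 ^ k +_) (sym (+-identityʳ (2 ^ k)))))

  multiplicity : Point → List Point → ℕ
  multiplicity t ℓ = ∑ₗ (δ² t) ℓ

  ∑ₗ-as-∑² : ∀ {A : Set} (h : A → Point) (f : Point → ℕ) {xs} → All (InGrid ∘ h) xs →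
             ∑ₗ (f ∘ h) xs ≡ ∑² (λ t → f t * ∑ₗ (δ² t ∘ h) xs)
  ∑ₗ-as-∑² h f []                      = sym (trans (∑²-*ʳ 0 f) (*-zeroʳ (∑² f)))
  ∑ₗ-as-∑² h f {x ∷ xs} (hx∈grid ∷ xs⊆grid) = begin
      f (h x) + ∑ₗ (f ∘ h) xs
        ≡⟨ cong₂ _+_ (∑²-*-δ² hx∈grid f) (sym (∑ₗ-as-∑² h f xs⊆grid)) ⟨
      ∑² (λ t → f t * δ² t (h x)) + ∑² (λ t → f t * ∑ₗ (δ² t ∘ h) xs)
        ≡⟨ ∑²-distrib-+ _ _ ⟨
      ∑² (λ t → f t * δ² t (h x) + f t * ∑ₗ (δ² t ∘ h) xs)
        ≡⟨ ∑²-cong (λ t _ → *-distribˡ-+ (f t) (δ² t (h x)) (∑ₗ (δ² t ∘ h) xs)) ⟨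
      ∑² (λ t → f t * ∑ₗ (δ² t ∘ h) (x ∷ xs)) ∎
    where open ≡-Reasoning

  multiplicity-origin : ∀ {ℓ} → All NonOrigin ℓ → multiplicity (0 , 0) ℓ ≡ 0
  multiplicity-origin []                 = refl
  multiplicity-origin {s ∷ ℓ} (s≢0 ∷ ℓ≢0) = cong₂ _+_ (trans (δ²-comm (0 , 0) s) (δ²-origin s≢0)) (multiplicity-origin ℓ≢0)

  ∈⇒1≤multiplicity : ∀ {t ℓ} → t ∈ ℓ → 1 ≤ multiplicity t ℓ
  ∈⇒1≤multiplicity {t} {_ ∷ ℓ} (here refl) = subst (λ k → 1 ≤ k + multiplicity t ℓ) (sym (δ²-refl t)) (s≤s z≤n)
  ∈⇒1≤multiplicity {t} {s ∷ ℓ} (there t∈ℓ) = ≤-trans (∈⇒1≤multiplicity t∈ℓ) (m≤n+m _ (δ² t s))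

  Covers : List Point → Set
  Covers ℓ = ∀ t → Punctured t → t ∈ ℓ

  -- For ℓ covering the punctured points, ∑ₗ f ℓ is ∑² f plus the sum of f over the repeats,
  -- which lies between L * excess ℓ and U * excess ℓ.
  excess : List Point → ℕ
  excess ℓ = ∑² (λ t → multiplicity t ℓ ∸ 1)

  All-punctured⇒inGrid : ∀ {ℓ} → All Punctured ℓ → All InGrid ℓ
  All-punctured⇒inGrid = All.map proj₁

  All-punctured⇒nonOrigin : ∀ {ℓ} → All Punctured ℓ → All NonOrigin ℓ
  All-punctured⇒nonOrigin = All.map proj₂

  excess-+-∑²-nonOrigin : ∀ {ℓ} → All Punctured ℓ → Covers ℓ →
                           excess ℓ + ∑² 𝟙-nonOrigin ≡ ∑ₗ (λ _ → 1) ℓ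
  excess-+-∑²-nonOrigin {ℓ} ℓ⊆ covers = begin
      excess ℓ + ∑² 𝟙-nonOrigin                        ≡⟨ ∑²-distrib-+ _ 𝟙-nonOrigin ⟨
      ∑² (λ t → (multiplicity t ℓ ∸ 1) + 𝟙-nonOrigin t)  ≡⟨ ∑²-cong pointwise ⟩
      ∑² (λ t → 1 * multiplicity t ℓ)                   ≡⟨ ∑ₗ-as-∑² id (λ _ → 1) {ℓ} (All-punctured⇒inGrid ℓ⊆) ⟨
      ∑ₗ (λ _ → 1) ℓ                                    ∎
    where
    open ≡-Reasoning
    pointwise : ∀ t → InGrid t → (multiplicity t ℓ ∸ 1) + 𝟙-nonOrigin t ≡ 1 * multiplicity t ℓ
    pointwise t t∈grid with originView t
    ... | origin = begin
      (multiplicity (0 , 0) ℓ ∸ 1) + 𝟙-nonOrigin (0 , 0)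
        ≡⟨ cong₂ (λ m i → (m ∸ 1) + i) (multiplicity-origin (All-punctured⇒nonOrigin ℓ⊆)) 𝟙-nonOrigin-origin ⟩
      0                                                  ≡⟨ multiplicity-origin (All-punctured⇒nonOrigin ℓ⊆) ⟨
      multiplicity (0 , 0) ℓ                             ≡⟨ *-identityˡ _ ⟨
      1 * multiplicity (0 , 0) ℓ                         ∎
    ... | nonOrigin t≢0 = begin
      (multiplicity t ℓ ∸ 1) + (1 ∸ δ² t (0 , 0))  ≡⟨ cong (λ d → (multiplicity t ℓ ∸ 1) + (1 ∸ d)) (δ²-origin t≢0) ⟩
      (multiplicity t ℓ ∸ 1) + 1                   ≡⟨ m∸n+n≡m (∈⇒1≤multiplicity (covers t (t∈grid , t≢0))) ⟩
      multiplicity t ℓ                             ≡⟨ *-identityˡ _ ⟨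
      1 * multiplicity t ℓ                         ∎

  ∑ₗ≤∑²+excess : ∀ (f : Point → ℕ) U {ℓ} → All InGrid ℓ → (∀ t → InGrid t → f t ≤ U) →
                 ∑ₗ f ℓ ≤ ∑² f + U * excess ℓ
  ∑ₗ≤∑²+excess f U {ℓ} ℓ⊆grid f≤U = begin
      ∑ₗ f ℓ                                          ≡⟨ ∑ₗ-as-∑² id f ℓ⊆grid ⟩
      ∑² (λ t → f t * multiplicity t ℓ)              ≤⟨ ∑²-mono-≤ (λ t t∈grid → pointwise (f t) _ (f≤U t t∈grid)) ⟩
      ∑² (λ t → f t + U * (multiplicity t ℓ ∸ 1))    ≡⟨ ∑²-distrib-+ f _ ⟩
      ∑² f + ∑² (λ t → U * (multiplicity t ℓ ∸ 1))   ≡⟨ cong (∑² f +_) (∑²-*ˡ U _) ⟩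
      ∑² f + U * excess ℓ                             ∎
    where
    open ≤-Reasoning
    pointwise : ∀ x k → x ≤ U → x * k ≤ x + U * (k ∸ 1)
    pointwise x zero    _   = subst (_≤ x + U * 0) (sym (*-zeroʳ x)) z≤n
    pointwise x (suc k) x≤U = subst (_≤ x + U * k) (sym (*-suc x k)) (+-monoʳ-≤ x (*-monoˡ-≤ k x≤U))

  ∑²+excess≤∑ₗ : ∀ (f : Point → ℕ) L {ℓ} → All Punctured ℓ → Covers ℓ →
                 (∀ t → Punctured t → L ≤ f t) → f (0 , 0) ≡ 0 →
                 ∑² f + L * excess ℓ ≤ ∑ₗ f ℓ
  ∑²+excess≤∑ₗ f L {ℓ} ℓ⊆ covers L≤f f0≡0 = begin
      ∑² f + L * excess ℓ                             ≡⟨ cong (∑² f +_) (∑²-*ˡ L _) ⟨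
      ∑² f + ∑² (λ t → L * (multiplicity t ℓ ∸ 1))   ≡⟨ ∑²-distrib-+ f _ ⟨
      ∑² (λ t → f t + L * (multiplicity t ℓ ∸ 1))    ≤⟨ ∑²-mono-≤ pointwise ⟩
      ∑² (λ t → f t * multiplicity t ℓ)              ≡⟨ ∑ₗ-as-∑² id f {ℓ} (All-punctured⇒inGrid ℓ⊆) ⟨
      ∑ₗ f ℓ                                          ∎
    where
    open ≤-Reasoning
    pointwise : ∀ t → InGrid t → f t + L * (multiplicity t ℓ ∸ 1) ≤ f t * multiplicity t ℓ
    pointwise t t∈grid with originView t
    ... | origin = ≤-reflexive (begin-equality
      f (0 , 0) + L * (multiplicity (0 , 0) ℓ ∸ 1)
        ≡⟨ cong₂ (λ x m → x + L * (m ∸ 1)) f0≡0 (multiplicity-origin (All-punctured⇒nonOrigin ℓ⊆)) ⟩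
      L * 0                                        ≡⟨ *-zeroʳ L ⟩
      0                                            ≡⟨ cong (_* multiplicity (0 , 0) ℓ) f0≡0 ⟨
      f (0 , 0) * multiplicity (0 , 0) ℓ           ∎)
    ... | nonOrigin t≢0 = begin
      f t + L * (multiplicity t ℓ ∸ 1)        ≤⟨ +-monoʳ-≤ (f t) (*-monoˡ-≤ _ (L≤f t (t∈grid , t≢0))) ⟩
      f t + f t * (multiplicity t ℓ ∸ 1)      ≡⟨ *-suc (f t) _ ⟨
      f t * suc (multiplicity t ℓ ∸ 1)        ≡⟨ cong (f t *_) (+-comm 1 _) ⟩
      f t * (multiplicity t ℓ ∸ 1 + 1)        ≡⟨ cong (f t *_) (m∸n+n≡m (∈⇒1≤multiplicity (covers t (t∈grid , t≢0)))) ⟩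
      f t * multiplicity t ℓ                  ∎

module Reachability (p : ℕ) (p-prime : Prime p) where

  open import Data.Nat
  open import Data.Nat.Properties
  open import Data.Nat.DivMod
  open import Data.Nat.Tactic.RingSolver using (solve-∀)
  open import Data.Nat.Primality using (prime⇒nonZero; prime⇒nonTrivial)
  open import Data.Nat.Coprimality using (prime⇒coprime; coprime-Bézout)
  open import Data.Nat.GCD using (module Bézout)
  open import Data.Product using (_×_; _,_; ∃-syntax)
  open import Data.Sum using (inj₁; inj₂)
  open import Data.List using (_++_)
  open import Data.List.Relation.Unary.Any using (here; there)
  open import Data.List.Membership.Propositional using (_∈_)
  open import Data.List.Membership.Propositional.Properties using (∈-++⁻; ∈-++⁺ˡ; ∈-++⁺ʳ)
  open import Relation.Binary.PropositionalEquality
  open import Relation.Nullary using (yes; no)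

  instance
    p≢0 : NonZero p
    p≢0 = prime⇒nonZero p-prime

  open Residues p
  open Walk p

  1<p : 1 < p
  1<p = nonTrivial⇒n>1 p {{prime⇒nonTrivial p-prime}}

  0<p : 0 < p
  0<p = >-nonZero⁻¹ p

  residue-inverse : ∀ {d} → 0 < d → d < p → ∃[ w ] w * d ≡ₘ 1
  residue-inverse {d} 0<d d<p with coprime-Bézout (prime⇒coprime p-prime {{>-nonZero 0<d}} d<p)
  ... | Bézout.-+ x y 1+xp≡yd = y , trans (cong (_% p) (sym 1+xp≡yd)) ([m+kn]%n≡m%n 1 x p)
  ... | Bézout.+- x y 1+yd≡xp = (p ∸ 1) * y , (begin
      W % p                        ≡⟨ [m+n]%n≡m%n W p ⟨
      (W + p) % p                  ≡⟨ cong (λ k → (W + k) % p) (m∸n+n≡m 0<p) ⟨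
      (W + (p ∸ 1 + 1)) % p        ≡⟨ cong (_% p) (+-assoc W (p ∸ 1) 1) ⟨
      (W + (p ∸ 1) + 1) % p        ≡⟨ +-cong-≡ₘ {W + (p ∸ 1)} {0} {1} W+p-1≡ₘ0 refl ⟩
      1 % p                        ∎)
    where
    open ≡-Reasoning
    -- 1 + y d = x p makes (p - 1) y d ≡ -(p - 1) ≡ 1
    W = (p ∸ 1) * y * d
    distrib : ∀ a y d → a * y * d + a ≡ a * (1 + y * d)
    distrib = solve-∀
    W+p-1≡p-1*x*p : W + (p ∸ 1) ≡ (p ∸ 1) * x * p
    W+p-1≡p-1*x*p = trans (distrib (p ∸ 1) y d) (trans (cong ((p ∸ 1) *_) 1+yd≡xp) (sym (*-assoc (p ∸ 1) x p)))
    W+p-1≡ₘ0 : W + (p ∸ 1) ≡ₘ 0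
    W+p-1≡ₘ0 = trans (cong (_% p) W+p-1≡p-1*x*p) (trans (m*n%n≡0 ((p ∸ 1) * x) p) (sym 0%q≡0))

  solve-linear : ∀ u x {d} → 0 < d → d < p → x < p → ∃[ j ] j < p × (u + j * d) % p ≡ x
  solve-linear u x {d} 0<d d<p x<p with residue-inverse 0<d d<p
  ... | w , wd≡1 = (w * r) % p , m%n<n _ p , (begin
      (u + (w * r) % p * d) % p   ≡⟨ +-congˡ-≡ₘ u (*-cong-≡ₘ {(w * r) % p} {w * r} {d} {d} (%-≡ₘ (w * r)) refl) ⟩
      (u + w * r * d) % p         ≡⟨ cong (λ k → (u + k) % p) (trans (cong (_* d) (*-comm w r)) (*-assoc r w d)) ⟩
      (u + r * (w * d)) % p       ≡⟨ +-congˡ-≡ₘ u (*-cong-≡ₘ {r} {r} {w * d} {1} refl wd≡1) ⟩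
      (u + r * 1) % p             ≡⟨ cong (λ k → (u + k) % p) (*-identityʳ r) ⟩
      (u + (x + (p ∸ u % p))) % p ≡⟨ cong (_% p) (rearrange u x (p ∸ u % p)) ⟩
      (x + ((p ∸ u % p) + u)) % p ≡⟨ +-congˡ-≡ₘ x (∸%+≡ₘ0 u) ⟩
      (x + 0) % p                 ≡⟨ cong (_% p) (+-identityʳ x) ⟩
      x % p                       ≡⟨ m<n⇒m%n≡m x<p ⟩
      x                           ∎)
    where
    open ≡-Reasoning
    r = x + (p ∸ u % p)
    rearrange : ∀ u x y → u + (x + y) ≡ x + (y + u)
    rearrange = solve-∀

  ∈-ancestors-+ : ∀ a {b s t r} → t ∈ ancestors a s → r ∈ ancestors b t → r ∈ ancestors (a + b) s
  ∈-ancestors-+ zero    (here refl) r∈ = r∈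
  ∈-ancestors-+ (suc a) {b} {s} t∈ r∈ with ∈-++⁻ (ancestors a (leftParent s)) t∈
  ... | inj₁ t∈ˡ = ∈-++⁺ˡ (∈-ancestors-+ a t∈ˡ r∈)
  ... | inj₂ t∈ʳ = ∈-++⁺ʳ (ancestors (a + b) (leftParent s)) (∈-ancestors-+ a t∈ʳ r∈)

  ∈-ancestors-suc : ∀ a {s t r} → t ∈ ancestors a s → r ∈ ancestors 1 t → r ∈ ancestors (suc a) s
  ∈-ancestors-suc a {s} {r = r} t∈ r∈ = subst (λ k → r ∈ ancestors k s) (+-comm a 1) (∈-ancestors-+ a t∈ r∈)

  leftParent∈ancestors : ∀ s → leftParent s ∈ ancestors 1 s
  leftParent∈ancestors s = here refl

  rightParent∈ancestors : ∀ s → rightParent s ∈ ancestors 1 s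
  rightParent∈ancestors s = there (here refl)

  private
    step-mod : ∀ u j d → (((u + j * d) % p) + d) % p ≡ (u + suc j * d) % p
    step-mod u j d = trans (+-cong-≡ₘ {(u + j * d) % p} {u + j * d} {d} {d} (%-≡ₘ _) refl)
                           (cong (_% p) (trans (+-assoc u (j * d) d) (cong (u +_) (+-comm (j * d) d))))

  rightParent^-∈ : ∀ j {u} v → u < p → ((u + j * (p ∸ v)) % p , v) ∈ ancestors j (u , v)
  rightParent^-∈ zero    {u} v u<p = here (cong (_, v) (trans (cong (_% p) (+-identityʳ u)) (m<n⇒m%n≡m u<p)))
  rightParent^-∈ (suc j) {u} v u<p = ∈-ancestors-suc j (rightParent^-∈ j v u<p)
    (subst (_∈ ancestors 1 ((u + j * (p ∸ v)) % p , v)) (cong (_, v) (step-mod u j (p ∸ v)))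
           (rightParent∈ancestors ((u + j * (p ∸ v)) % p , v)))

  leftParent^-∈ : ∀ j u {v} → v < p → (u , (v + j * (p ∸ u)) % p) ∈ ancestors j (u , v)
  leftParent^-∈ zero    u {v} v<p = here (cong (u ,_) (trans (cong (_% p) (+-identityʳ v)) (m<n⇒m%n≡m v<p)))
  leftParent^-∈ (suc j) u {v} v<p = ∈-ancestors-suc j (leftParent^-∈ j u v<p)
    (subst (_∈ ancestors 1 (u , (v + j * (p ∸ u)) % p)) (cong (u ,_) (step-mod v j (p ∸ u)))
           (leftParent∈ancestors (u , (v + j * (p ∸ u)) % p)))

  Reachable≤ : ℕ → Point → Point → Set
  Reachable≤ k s t = ∃[ j ] j ≤ k × t ∈ ancestors j s

  Reachable≤-trans : ∀ {a b s t r} → Reachable≤ a s t → Reachable≤ b t r → Reachable≤ (a + b) s r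
  Reachable≤-trans (i , i≤a , t∈) (j , j≤b , r∈) = i + j , +-mono-≤ i≤a j≤b , ∈-ancestors-+ i t∈ r∈

  Reachable≤-mono : ∀ {a b s t} → a ≤ b → Reachable≤ a s t → Reachable≤ b s t
  Reachable≤-mono a≤b (j , j≤a , t∈) = j , ≤-trans j≤a a≤b , t∈

  private
    0<p∸ : ∀ {v} → v < p → 0 < p ∸ v
    0<p∸ = m<n⇒0<n∸m

    p∸<p : ∀ {v} → 0 < v → v < p → p ∸ v < p
    p∸<p 0<v v<p = ∸-monoʳ-< 0<v (<⇒≤ v<p)

  reach-first : ∀ {u v} x → u < p → 0 < v → v < p → x < p → Reachable≤ p (u , v) (x , v)
  reach-first {u} {v} x u<p 0<v v<p x<p with solve-linear u x (0<p∸ v<p) (p∸<p 0<v v<p) x<p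
  ... | j , j<p , u+jd≡x = j , <⇒≤ j<p , subst (_∈ ancestors j (u , v)) (cong (_, v) u+jd≡x) (rightParent^-∈ j v u<p)

  reach-second : ∀ {u v} y → 0 < u → u < p → v < p → y < p → Reachable≤ p (u , v) (u , y)
  reach-second {u} {v} y 0<u u<p v<p y<p with solve-linear v y (0<p∸ u<p) (p∸<p 0<u u<p) y<p
  ... | j , j<p , v+jd≡y = j , <⇒≤ j<p , subst (_∈ ancestors j (u , v)) (cong (u ,_) v+jd≡y) (leftParent^-∈ j u v<p)

  -- (1 , 0) is its own right parent, so paths through it can be padded to a common length.
  hub : Point
  hub = (1 , 0)

  private
    0<1 : 0 < 1
    0<1 = s≤s z≤n

    2p≤3p : p + p ≤ p + (p + p)
    2p≤3p = +-monoʳ-≤ p (m≤n+m p p)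

  reach-hub : ∀ {s} → Punctured s → Reachable≤ (p + (p + p)) s hub
  reach-hub {u , v} ((u<p , v<p) , s≢0) with v ≟ 0
  ... | yes refl = Reachable≤-trans (reach-second 1 0<u u<p v<p 1<p)
                     (Reachable≤-trans (reach-first 1 u<p 0<1 1<p 1<p) (reach-second 0 0<1 1<p 1<p 0<p))
    where 0<u = n≢0⇒n>0 (λ u≡0 → s≢0 (u≡0 , refl))
  ... | no v≢0 = Reachable≤-mono 2p≤3p
                   (Reachable≤-trans (reach-first 1 u<p (n≢0⇒n>0 v≢0) v<p 1<p) (reach-second 0 0<1 1<p v<p 0<p))

  hub-reach : ∀ {t} → Punctured t → Reachable≤ (p + (p + p)) hub t
  hub-reach {x , y} ((x<p , y<p) , t≢0) with x ≟ 0
  ... | yes refl = Reachable≤-mono 2p≤3p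
                     (Reachable≤-trans (reach-second y 0<1 1<p 0<p y<p) (reach-first 0 1<p 0<y y<p 0<p))
    where 0<y = n≢0⇒n>0 (λ y≡0 → t≢0 (refl , y≡0))
  ... | no x≢0 = Reachable≤-trans (reach-second 1 0<1 1<p 0<p 1<p)
                   (Reachable≤-trans (reach-first x 1<p 0<1 1<p x<p) (reach-second y (n≢0⇒n>0 x≢0) x<p 1<p y<p))

  hub∈ancestors-hub : hub ∈ ancestors 1 hub
  hub∈ancestors-hub = subst (λ t → t ∈ ancestors 1 hub) (cong (_, 0) ([v+q]%q≡v 1<p)) (rightParent∈ancestors hub)

  ∈-ancestors-padʳ : ∀ j m {s} → hub ∈ ancestors j s → hub ∈ ancestors (j + m) s
  ∈-ancestors-padʳ j zero    {s} hub∈ = subst (λ k → hub ∈ ancestors k s) (sym (+-identityʳ j)) hub∈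
  ∈-ancestors-padʳ j (suc m) {s} hub∈ = subst (λ k → hub ∈ ancestors k s) (sym (+-suc j m))
                                          (∈-ancestors-suc (j + m) (∈-ancestors-padʳ j m hub∈) hub∈ancestors-hub)

  ∈-ancestors-padˡ : ∀ m j {t} → t ∈ ancestors j hub → t ∈ ancestors (m + j) hub
  ∈-ancestors-padˡ zero    j t∈ = t∈
  ∈-ancestors-padˡ (suc m) j t∈ = ∈-ancestors-+ 1 {m + j} hub∈ancestors-hub (∈-ancestors-padˡ m j t∈)

  mixingTime : ℕ
  mixingTime = (p + (p + p)) + (p + (p + p))

  ∈-ancestors-mixingTime : ∀ {s t} → Punctured s → Punctured t → t ∈ ancestors mixingTime s
  ∈-ancestors-mixingTime {s} {t} s∈ t∈ with reach-hub s∈ | hub-reach t∈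
  ... | i , i≤ , hub∈ | j , j≤ , t∈′ =
    ∈-ancestors-+ (p + (p + p))
      (subst (λ k → hub ∈ ancestors k s) (m+[n∸m]≡n i≤) (∈-ancestors-padʳ i (p + (p + p) ∸ i) hub∈))
      (subst (λ k → t ∈ ancestors k hub) (m∸n+n≡m j≤) (∈-ancestors-padˡ (p + (p + p) ∸ j) j t∈′))

module Mixing (p : ℕ) (p-prime : Prime p) where

  open import Data.Nat
  open import Data.Nat.Properties
  open import Data.Nat.Tactic.RingSolver using (solve-∀)
  open import Data.Product using (_×_; _,_; ∃₂)
  open import Relation.Binary.PropositionalEquality
  open FiniteSum using (∑ₗ)

  open Reachability p p-prime
  open Walk p

  #punctured : ℕ
  #punctured = ∑² 𝟙-nonOrigin

  #punctured≡[p+1][p∸1] : #punctured ≡ suc p * (p ∸ 1)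
  #punctured≡[p+1][p∸1] = +-cancelʳ-≡ 1 _ _
    (trans ∑²-nonOrigin (sym (subst (λ x → suc x * (x ∸ 1) + 1 ≡ x * x) p≡1+[p∸1] (identity (p ∸ 1)))))
    where
    p≡1+[p∸1] : suc (p ∸ 1) ≡ p
    p≡1+[p∸1] = m+[n∸m]≡n (<⇒≤ 1<p)
    identity : ∀ m → suc (suc m) * m + 1 ≡ suc m * suc m
    identity = solve-∀

  -- Of the 2 ^ mixingTime ancestors of a punctured point, all but #punctured are repeats
  surplus : ℕ
  surplus = 2 ^ mixingTime ∸ #punctured

  excess-ancestors : ∀ {s} → Punctured s → excess (ancestors mixingTime s) ≡ surplus
  excess-ancestors {s} s∈ = trans (sym (m+n∸n≡m _ #punctured)) (cong (_∸ #punctured) (begin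
      excess ℓ + #punctured  ≡⟨ excess-+-∑²-nonOrigin (ancestors-punctured mixingTime s∈) (λ t t∈ → ∈-ancestors-mixingTime s∈ t∈) ⟩
      ∑ₗ (λ _ → 1) ℓ         ≡⟨ ∑ₗ-1-ancestors mixingTime s ⟩
      2 ^ mixingTime         ∎))
    where
    open ≡-Reasoning
    ℓ = ancestors mixingTime s

  record Bounds (n L U : ℕ) : Set where
    constructor bounds
    field
      upper : ∀ t → InGrid t → count n t ≤ U
      lower : ∀ t → Punctured t → L ≤ count n t

  -- Doeblin contraction: the spread U ∸ L is multiplied by surplus < 2 ^ mixingTime.
  Bounds-contract : ∀ {n L U} → Bounds n L U →
                    Bounds (mixingTime + n) (2 ^ n + L * surplus) (2 ^ n + U * surplus)
  Bounds-contract {n} {L} {U} (bounds ≤U L≤) = bounds upper lower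
    where
    open ≤-Reasoning
    upper : ∀ t → InGrid t → count (mixingTime + n) t ≤ 2 ^ n + U * surplus
    upper t t∈grid with originView t
    ... | origin = subst (_≤ 2 ^ n + U * surplus) (sym (count-origin 1<p (mixingTime + n))) z≤n
    ... | nonOrigin t≢0 = begin
        count (mixingTime + n) t                         ≡⟨ count-+ mixingTime n t ⟩
        ∑ₗ (count n) (ancestors mixingTime t)
          ≤⟨ ∑ₗ≤∑²+excess (count n) U (All-punctured⇒inGrid (ancestors-punctured mixingTime t∈)) ≤U ⟩
        ∑² (count n) + U * excess (ancestors mixingTime t) ≡⟨ cong₂ (λ a e → a + U * e) (∑²-count n) (excess-ancestors t∈) ⟩
        2 ^ n + U * surplus                             ∎
      where t∈ = t∈grid , t≢0
    lower : ∀ t → Punctured t → 2 ^ n + L * surplus ≤ count (mixingTime + n) t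
    lower t t∈ = begin
        2 ^ n + L * surplus                             ≡⟨ cong₂ (λ a e → a + L * e) (∑²-count n) (excess-ancestors t∈) ⟨
        ∑² (count n) + L * excess (ancestors mixingTime t) ≤⟨ ∑²+excess≤∑ₗ (count n) L (ancestors-punctured mixingTime t∈)
                                                               (λ s s∈ → ∈-ancestors-mixingTime t∈ s∈) L≤ (count-origin 1<p n) ⟩
        ∑ₗ (count n) (ancestors mixingTime t)           ≡⟨ count-+ mixingTime n t ⟨
        count (mixingTime + n) t                         ∎

  Bounds-iterate : ∀ r j → ∃₂ λ L U → Bounds (j * mixingTime + r) L U × U ≤ L + 2 ^ r * surplus ^ j
  Bounds-iterate r zero    = 0 , 2 ^ r , bounds (λ t _ → count≤2^n r t) (λ _ _ → z≤n) , ≤-reflexive (sym (*-identityʳ (2 ^ r)))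
  Bounds-iterate r (suc j) with Bounds-iterate r j
  ... | L , U , LU-bounds , U≤L+D =
    2 ^ n + L * surplus , 2 ^ n + U * surplus ,
    subst (λ m → Bounds m (2 ^ n + L * surplus) (2 ^ n + U * surplus)) (sym (+-assoc mixingTime (j * mixingTime) r)) (Bounds-contract LU-bounds) ,
    ≤-trans (+-monoʳ-≤ (2 ^ n) (*-monoˡ-≤ surplus U≤L+D)) (≤-reflexive (rearrange (2 ^ n) L (2 ^ r) (surplus ^ j) surplus))
    where
    n = j * mixingTime + r
    rearrange : ∀ a L b e s → a + (L + b * e) * s ≡ a + L * s + b * (s * e)
    rearrange = solve-∀

  ∑²-*-count-≤ : ∀ {n L U} → Bounds n L U → ∀ g → ∑² (λ t → g t * count n t) ≤ ∑² g * U
  ∑²-*-count-≤ {n} {U = U} (bounds ≤U _) g =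
    ≤-trans (∑²-mono-≤ (λ t t∈grid → *-monoʳ-≤ (g t) (≤U t t∈grid))) (≤-reflexive (∑²-*ʳ U g))

  ∑²-*-count-≥ : ∀ {n L U} → Bounds n L U → ∀ g → g (0 , 0) ≡ 0 → ∑² g * L ≤ ∑² (λ t → g t * count n t)
  ∑²-*-count-≥ {n} {L} (bounds _ L≤) g g0≡0 = ≤-trans (≤-reflexive (sym (∑²-*ʳ L g))) (∑²-mono-≤ pointwise)
    where
    pointwise : ∀ t → InGrid t → g t * L ≤ g t * count n t
    pointwise t t∈grid with originView t
    ... | origin        = subst (λ x → x * L ≤ x * count n (0 , 0)) (sym g0≡0) z≤n
    ... | nonOrigin t≢0 = *-monoʳ-≤ (g t) (L≤ t (t∈grid , t≢0))

  ∑²-nonOrigin-*-count : ∀ n → ∑² (λ t → 𝟙-nonOrigin t * count n t) ≡ 2 ^ n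
  ∑²-nonOrigin-*-count n = trans (∑²-cong pointwise) (∑²-count n)
    where
    pointwise : ∀ t → InGrid t → 𝟙-nonOrigin t * count n t ≡ count n t
    pointwise t _ with originView t
    ... | origin        = trans (cong (_* count n (0 , 0)) 𝟙-nonOrigin-origin) (sym (count-origin 1<p n))
    ... | nonOrigin t≢0 = trans (cong (λ d → (1 ∸ d) * count n t) (δ²-origin t≢0)) (*-identityˡ (count n t))

  equidistribution : ∀ r j (g : Point → ℕ) → g (0 , 0) ≡ 0 →
    let n = j * mixingTime + r
        X = #punctured * (2 ^ r * surplus ^ j)
    in  #punctured * ∑² (λ t → g t * count n t) ≤ ∑² g * (2 ^ n + X)
      × ∑² g * 2 ^ n ≤ #punctured * ∑² (λ t → g t * count n t) + ∑² g * X
  equidistribution r j g g0≡0 with Bounds-iterate r j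
  ... | L , U , LU-bounds , U≤L+D = upper , lower
    where
    n = j * mixingTime + r
    D = 2 ^ r * surplus ^ j
    Z = #punctured
    G = ∑² g
    T = ∑² (λ t → g t * count n t)
    swap : ∀ a b c → a * (b * c) ≡ b * (a * c)
    swap = solve-∀
    ZL≤2^n : Z * L ≤ 2 ^ n
    ZL≤2^n = subst (Z * L ≤_) (∑²-nonOrigin-*-count n) (∑²-*-count-≥ LU-bounds 𝟙-nonOrigin 𝟙-nonOrigin-origin)
    2^n≤ZU : 2 ^ n ≤ Z * U
    2^n≤ZU = subst (_≤ Z * U) (∑²-nonOrigin-*-count n) (∑²-*-count-≤ LU-bounds 𝟙-nonOrigin)
    open ≤-Reasoning
    upper : Z * T ≤ G * (2 ^ n + Z * D)
    upper = begin
      Z * T                ≤⟨ *-monoʳ-≤ Z (∑²-*-count-≤ LU-bounds g) ⟩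
      Z * (G * U)          ≡⟨ swap Z G U ⟩
      G * (Z * U)          ≤⟨ *-monoʳ-≤ G (*-monoʳ-≤ Z U≤L+D) ⟩
      G * (Z * (L + D))    ≡⟨ cong (G *_) (*-distribˡ-+ Z L D) ⟩
      G * (Z * L + Z * D)  ≤⟨ *-monoʳ-≤ G (+-monoˡ-≤ (Z * D) ZL≤2^n) ⟩
      G * (2 ^ n + Z * D)  ∎
    lower : G * 2 ^ n ≤ Z * T + G * (Z * D)
    lower = begin
      G * 2 ^ n                ≤⟨ *-monoʳ-≤ G 2^n≤ZU ⟩
      G * (Z * U)              ≤⟨ *-monoʳ-≤ G (*-monoʳ-≤ Z U≤L+D) ⟩
      G * (Z * (L + D))        ≡⟨ cong (G *_) (*-distribˡ-+ Z L D) ⟩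
      G * (Z * L + Z * D)      ≡⟨ *-distribˡ-+ G (Z * L) (Z * D) ⟩
      G * (Z * L) + G * (Z * D) ≡⟨ cong (_+ G * (Z * D)) (swap G Z L) ⟩
      Z * (G * L) + G * (Z * D) ≤⟨ +-monoˡ-≤ (G * (Z * D)) (*-monoʳ-≤ Z (∑²-*-count-≥ LU-bounds g g0≡0)) ⟩
      Z * T + G * (Z * D)      ∎

module CalkinWilfResidues (p : ℕ) .{{_ : NonZero p}} where

  open import Data.Nat
  open import Data.Nat.Properties
  open import Data.Nat.DivMod
  open import Data.Nat.Divisibility using (_∣_; _∣?_; m%n≡0⇒n∣m; n∣m⇒m%n≡0)
  open import Data.Nat.Tactic.RingSolver using (solve-∀)
  import Data.Integer as ℤ
  open import Data.Product using (_×_; _,_)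
  open import Data.List using (List; []; _∷_; length; filterᵇ; concatMap)
  open import Data.List.Relation.Unary.All using (All; []; _∷_)
  open import Function using (_∘_)
  open import Relation.Binary.PropositionalEquality
  open import Relation.Nullary using (yes; no; ¬_)
  open import Algebra.Properties.CommutativeSemigroup +-commutativeSemigroup
    using () renaming (interchange to +-interchange)
  open import Defs
  open FiniteSum
  open Residues p
  open Walk p

  residues : ℕ × ℕ → Point
  residues (a , b) = (a % p , b % p)

  residues-inGrid : ∀ xs → All (InGrid ∘ residues) xs
  residues-inGrid []       = []
  residues-inGrid (x ∷ xs) = (m%n<n _ p , m%n<n _ p) ∷ residues-inGrid xs

  residueCount : Point → List (ℕ × ℕ) → ℕ
  residueCount t xs = ∑ₗ (δ² t ∘ residues) xs

  private
    [a+b]-a≡ₘb : ∀ a b → (a + b) % p + (p ∸ a % p) ≡ₘ b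
    [a+b]-a≡ₘb a b = begin
      ((a + b) % p + (p ∸ a % p)) % p ≡⟨ +-cong-≡ₘ {(a + b) % p} {a + b} {p ∸ a % p} (%-≡ₘ (a + b)) refl ⟩
      (a + b + (p ∸ a % p)) % p       ≡⟨ cong (_% p) (rearrange a b (p ∸ a % p)) ⟩
      (b + ((p ∸ a % p) + a)) % p     ≡⟨ +-congˡ-≡ₘ b (∸%+≡ₘ0 a) ⟩
      (b + 0) % p                     ≡⟨ cong (_% p) (+-identityʳ b) ⟩
      b % p                           ∎
      where
      open ≡-Reasoning
      rearrange : ∀ a b c → a + b + c ≡ b + (c + a)
      rearrange = solve-∀

    v-a≡ₘb⇒v≡a+b : ∀ {v} a b → v < p → v + (p ∸ a % p) ≡ₘ b → v ≡ (a + b) % p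
    v-a≡ₘb⇒v≡a+b {v} a b v<p v-a≡b = begin
      v                                   ≡⟨ [v+q]%q≡v v<p ⟨
      (v + p) % p                         ≡⟨ cong (λ k → (v + k) % p) (m∸n+n≡m (<⇒≤ (m%n<n a p))) ⟨
      (v + ((p ∸ a % p) + a % p)) % p     ≡⟨ cong (_% p) (+-assoc v _ _) ⟨
      ((v + (p ∸ a % p)) + a % p) % p     ≡⟨ +-cong-≡ₘ {v + (p ∸ a % p)} {(v + (p ∸ a % p)) % p} (sym (%-≡ₘ _)) (%-≡ₘ a) ⟩
      ((v + (p ∸ a % p)) % p + a) % p     ≡⟨ cong (λ k → (k + a) % p) v-a≡b ⟩
      (b % p + a) % p                     ≡⟨ +-cong-≡ₘ {b % p} {b} {a} (%-≡ₘ b) refl ⟩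
      (b + a) % p                         ≡⟨ cong (_% p) (+-comm b a) ⟩
      (a + b) % p                         ∎
      where open ≡-Reasoning

  δ²-leftChild : ∀ {u v} a b → v < p → δ² (u , v) (residues (a , a + b)) ≡ δ² (leftParent (u , v)) (residues (a , b))
  δ²-leftChild {u} {v} a b v<p with a % p ≟ u
  ... | yes refl = cong (δ (a % p) (a % p) *_) (δ-cong-⇔ (λ { refl → [a+b]-a≡ₘb a b }) (v-a≡ₘb⇒v≡a+b a b v<p))
  ... | no a≢u   = trans (cong (_* δ v ((a + b) % p)) (δ-≢ (a≢u ∘ sym)))
                     (sym (cong (_* δ ((v + (p ∸ u)) % p) (b % p)) (δ-≢ (a≢u ∘ sym))))

  δ²-rightChild : ∀ {u v} a b → u < p → δ² (u , v) (residues (a + b , b)) ≡ δ² (rightParent (u , v)) (residues (a , b))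
  δ²-rightChild {u} {v} a b u<p with b % p ≟ v
  ... | yes refl = cong (_* δ (b % p) (b % p))
                     (δ-cong-⇔ (λ { refl → subst (λ x → x % p + (p ∸ b % p) ≡ₘ a) (+-comm b a) ([a+b]-a≡ₘb b a) })
                               (λ u-b≡a → trans (v-a≡ₘb⇒v≡a+b b a u<p u-b≡a) (cong (_% p) (+-comm b a))))
  ... | no b≢v   = trans (cong (δ u ((a + b) % p) *_) (δ-≢ (b≢v ∘ sym)))
                     (trans (*-zeroʳ (δ u ((a + b) % p)))
                       (sym (trans (cong (δ ((u + (p ∸ v)) % p) (a % p) *_) (δ-≢ (b≢v ∘ sym))) (*-zeroʳ (δ ((u + (p ∸ v)) % p) (a % p))))))

  children : ℕ × ℕ → List (ℕ × ℕ)
  children (a , b) = (a , a + b) ∷ (a + b , b) ∷ []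

  residueCount-children : ∀ {t} → InGrid t → ∀ xs →
    residueCount t (concatMap children xs) ≡ residueCount (leftParent t) xs + residueCount (rightParent t) xs
  residueCount-children t∈grid [] = refl
  residueCount-children {u , v} t∈grid@(u<p , v<p) ((a , b) ∷ xs) = begin
      δ² (u , v) (residues (a , a + b)) + (δ² (u , v) (residues (a + b , b)) + residueCount (u , v) (concatMap children xs))
        ≡⟨ cong₂ _+_ (δ²-leftChild {u} a b v<p) (cong₂ _+_ (δ²-rightChild {v = v} a b u<p) (residueCount-children t∈grid xs)) ⟩
      A + (B + (X + Y)) ≡⟨ +-assoc A B (X + Y) ⟨
      (A + B) + (X + Y) ≡⟨ +-interchange A B X Y ⟩
      (A + X) + (B + Y) ∎
    where
    open ≡-Reasoning
    A = δ² (leftParent (u , v)) (residues (a , b))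
    B = δ² (rightParent (u , v)) (residues (a , b))
    X = residueCount (leftParent (u , v)) xs
    Y = residueCount (rightParent (u , v)) xs

  residueCount-cw : ∀ n {t} → InGrid t → residueCount t (cw n) ≡ count n t
  residueCount-cw zero    t∈grid = +-identityʳ _
  residueCount-cw (suc n) t∈grid = trans (residueCount-children t∈grid (cw n))
    (cong₂ _+_ (residueCount-cw n (leftParent-inGrid t∈grid)) (residueCount-cw n (rightParent-inGrid t∈grid)))

  ∑ₗ-cw : ∀ (g : Point → ℕ) n → ∑ₗ (g ∘ residues) (cw n) ≡ ∑² (λ t → g t * count n t)
  ∑ₗ-cw g n = trans (∑ₗ-as-∑² residues g (residues-inGrid (cw n)))
                    (∑²-cong (λ t t∈grid → cong (g t *_) (residueCount-cw n t∈grid)))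

  𝟙-line : ℕ → Point → ℕ
  𝟙-line c (u , v) = (1 ∸ δ v 0) * δ u ((c * v) % p)

  𝟙-line-origin : ∀ c → 𝟙-line c (0 , 0) ≡ 0
  𝟙-line-origin c = cong (λ d → (1 ∸ d) * δ 0 ((c * 0) % p)) (δ-refl 0)

  ∑²-line : ∀ c → ∑² (𝟙-line c) + 1 ≡ p
  ∑²-line c = begin
      ∑² (𝟙-line c) + 1
        ≡⟨ cong₂ _+_ (sym (∑²-comm (𝟙-line c))) (∑-δ p 0 (>-nonZero⁻¹ p)) ⟨
      ∑[ v < p ] ∑[ u < p ] ((1 ∸ δ v 0) * δ u ((c * v) % p)) + ∑[ v < p ] δ v 0
        ≡⟨ cong (_+ ∑[ v < p ] δ v 0) (∑-cong p (λ v _ → trans (∑-*ˡ p (1 ∸ δ v 0) (λ u → δ u ((c * v) % p)))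
             (trans (cong ((1 ∸ δ v 0) *_) (∑-δ p ((c * v) % p) (m%n<n _ p))) (*-identityʳ _)))) ⟩
      ∑[ v < p ] (1 ∸ δ v 0) + ∑[ v < p ] δ v 0
        ≡⟨ ∑-distrib-+ p (λ v → 1 ∸ δ v 0) (λ v → δ v 0) ⟨
      ∑[ v < p ] ((1 ∸ δ v 0) + δ v 0)
        ≡⟨ ∑-cong p (λ v _ → m∸n+n≡m (δ≤1 v 0)) ⟩
      ∑[ v < p ] 1
        ≡⟨ trans (∑-const p 1) (*-identityʳ p) ⟩
      p ∎
    where open ≡-Reasoning

  line-off-axis : ∀ c u {b} → ¬ p ∣ b → 𝟙-line c (u , b % p) ≡ δ u ((c * (b % p)) % p)
  line-off-axis c u {b} p∤b =
    trans (cong (λ d → (1 ∸ d) * δ u ((c * (b % p)) % p)) (δ-≢ (p∤b ∘ m%n≡0⇒n∣m b p))) (+-identityʳ _)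

  ordGe-line : ∀ (z : ℤ[ p ]) a b → 𝟙ᵇ (ordGe p z 1 (a , b)) ≡ 𝟙-line (res z 1) (residues (a , b))
  ordGe-line z a b with p ∣? b
  ... | yes p∣b = sym (cong (λ d → (1 ∸ d) * δ (a % p) ((c * (b % p)) % p))
                             (trans (cong (λ w → δ w 0) (n∣m⇒m%n≡0 b p p∣b)) (δ-refl 0)))
    where c = res z 1
  ... | no p∤b with p ^ 1 ∣? ℤ.∣ ℤ.+ a ℤ.- ℤ.+ (res z 1 * b) ∣
  ...   | yes p∣a-cb = sym (trans (line-off-axis c (a % p) p∤b) (trans (cong (δ (a % p)) cb≡a) (δ-refl (a % p))))
    where
    c = res z 1
    cb≡a : (c * (b % p)) % p ≡ a % p
    cb≡a = trans (*-cong-≡ₘ {c} {c} {b % p} {b} refl (%-≡ₘ b)) (sym (∣∣-∣⇒≡ₘ a (c * b) (subst (_∣ _) (*-identityʳ p) p∣a-cb)))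
  ...   | no p∤a-cb = sym (trans (line-off-axis c (a % p) p∤b) (δ-≢ λ a≡cb → p∤a-cb (subst (_∣ _) (sym (*-identityʳ p))
                          (≡ₘ⇒∣∣-∣ a (c * b) (trans a≡cb (*-cong-≡ₘ {c} {c} {b % p} {b} refl (%-≡ₘ b)))))))
    where c = res z 1

  length-filter-ordGe : ∀ (z : ℤ[ p ]) n →
    length (filterᵇ (ordGe p z 1) (cw n)) ≡ ∑² (λ t → 𝟙-line (res z 1) t * count n t)
  length-filter-ordGe z n = begin
      length (filterᵇ (ordGe p z 1) (cw n))          ≡⟨ length-filterᵇ (ordGe p z 1) (cw n) ⟩
      ∑ₗ (𝟙ᵇ ∘ ordGe p z 1) (cw n)                  ≡⟨ ∑ₗ-cong (cw n) (λ (a , b) → ordGe-line z a b) ⟩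
      ∑ₗ (𝟙-line (res z 1) ∘ residues) (cw n)       ≡⟨ ∑ₗ-cw (𝟙-line (res z 1)) n ⟩
      ∑² (λ t → 𝟙-line (res z 1) t * count n t)     ∎
    where open ≡-Reasoning

module PowerGrowth where

  open import Data.Nat
  open import Data.Nat.Properties
  open import Data.Nat.Tactic.RingSolver using (solve-∀)
  open import Data.Product using (_,_; ∃-syntax)
  open import Relation.Binary.PropositionalEquality

  -- Bernoulli's inequality (1 + 1/A)^j ≥ 1 + j/A, multiplied through by A^(j+1)
  bernoulli : ∀ A j → A ^ j * (A + j) ≤ A * suc A ^ j
  bernoulli A zero = ≤-reflexive (base A)
    where
    base : ∀ A → 1 * (A + 0) ≡ A * 1
    base = solve-∀
  bernoulli A (suc j) = begin
      A * X * (A + suc j)              ≡⟨ expand A X j ⟩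
      A * (X * (A + j)) + A * X        ≤⟨ +-monoʳ-≤ (A * (X * (A + j))) (subst (_≤ X * (A + j)) (*-comm X A) (*-monoʳ-≤ X (m≤m+n A j))) ⟩
      A * (X * (A + j)) + X * (A + j)  ≡⟨ collect A (X * (A + j)) ⟩
      suc A * (X * (A + j))            ≤⟨ *-monoʳ-≤ (suc A) (bernoulli A j) ⟩
      suc A * (A * Y)                  ≡⟨ swap A Y ⟩
      A * (suc A * Y)                  ∎
    where
    open ≤-Reasoning
    X = A ^ j
    Y = suc A ^ j
    expand : ∀ A X j → A * X * (A + suc j) ≡ A * (X * (A + j)) + A * X
    expand = solve-∀
    collect : ∀ A W → A * W + W ≡ suc A * W
    collect = solve-∀
    swap : ∀ A Y → suc A * (A * Y) ≡ A * (suc A * Y)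
    swap = solve-∀

  *-^-<-suc-^-eventually : ∀ M A → ∃[ J ] (∀ j → J ≤ j → M * A ^ j < suc A ^ j)
  *-^-<-suc-^-eventually M zero = 1 , λ { (suc j) _ → subst (_< 1 ^ suc j) (sym (*-zeroʳ M)) (m^n>0 1 (suc j)) }
  *-^-<-suc-^-eventually M (suc A-1) = suc (M * A) , λ j J≤j → *-cancelˡ-< A (M * A ^ j) (suc A ^ j) (begin-strict
      A * (M * A ^ j)   ≡⟨ rearrange A M (A ^ j) ⟩
      (M * A) * A ^ j   <⟨ *-monoˡ-< (A ^ j) {{m^n≢0 A j}} (≤-trans J≤j (m≤n+m j A)) ⟩
      (A + j) * A ^ j   ≡⟨ *-comm (A + j) (A ^ j) ⟩
      A ^ j * (A + j)   ≤⟨ bernoulli A j ⟩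
      A * suc A ^ j     ∎)
    where
    open ≤-Reasoning
    A = suc A-1
    rearrange : ∀ A M X → A * (M * X) ≡ (M * A) * X
    rearrange = solve-∀

module RationalBound where

  open import Data.Nat as ℕ using (ℕ; suc; NonZero)
  import Data.Nat.Properties as ℕP
  open import Data.Integer as ℤ using (+_)
  import Data.Integer.Properties as ℤP
  open import Data.Rational as ℚ using (ℚ; mkℚ; toℚᵘ)
  import Data.Rational.Properties as ℚP
  open import Data.Rational.Unnormalised as ℚᵘ using (ℚᵘ; mkℚᵘ; *<*)
  import Data.Rational.Unnormalised.Properties as ℚᵘP
  open import Data.Nat.Coprimality using (Coprime)
  open import Data.Sum using (inj₁; inj₂)
  open import Relation.Binary.PropositionalEquality

  private
    toℚᵘ-/ : ∀ i n .{{_ : NonZero n}} → toℚᵘ (i ℚ./ n) ℚᵘ.≃ mkℚᵘ i (n ℕ.∸ 1)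
    toℚᵘ-/ i (suc m) = ℚP.toℚᵘ-fromℚᵘ (mkℚᵘ i m)

    ∣⊖∣≤ : ∀ m n X → m ℕ.≤ n ℕ.+ X → n ℕ.≤ m ℕ.+ X → ℤ.∣ m ℤ.⊖ n ∣ ℕ.≤ X
    ∣⊖∣≤ m n X m≤n+X n≤m+X with ℕP.≤-total m n
    ... | inj₁ m≤n rewrite ℤP.∣⊖∣-≤ m≤n = ℕP.m≤n+o⇒m∸n≤o n m n≤m+X
    ... | inj₂ n≤m rewrite ℤP.∣m⊖n∣≡∣n⊖m∣ m n | ℤP.∣⊖∣-≤ n≤m = ℕP.m≤n+o⇒m∸n≤o m n m≤n+X

    ∣a/P-1/Q∣<ᵘ : ∀ a P-1 Q-1 num d-1 X → a ℕ.* suc Q-1 ℕ.≤ suc P-1 ℕ.+ X → suc P-1 ℕ.≤ a ℕ.* suc Q-1 ℕ.+ X →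
                  X ℕ.* suc d-1 ℕ.< num ℕ.* (suc P-1 ℕ.* suc Q-1) →
                  ℚᵘ.∣ mkℚᵘ (+ a) P-1 ℚᵘ.- mkℚᵘ (+ 1) Q-1 ∣ ℚᵘ.< mkℚᵘ (+ num) d-1
    ∣a/P-1/Q∣<ᵘ a P-1 Q-1 num d-1 X aQ≤P+X P≤aQ+X Xd<numPQ = *<* (subst₂ ℤ._<_ lhs rhs (ℤ.+<+ lt))
      where
      k = ℤ.∣ (a ℕ.* suc Q-1) ℤ.⊖ suc P-1 ∣
      numerator≡ : ℚᵘ.numerator ℚᵘ.∣ mkℚᵘ (+ a) P-1 ℚᵘ.- mkℚᵘ (+ 1) Q-1 ∣ ≡ + k
      numerator≡ = cong (λ i → + ℤ.∣ i ∣) (trans (cong₂ ℤ._+_ (sym (ℤP.pos-* a (suc Q-1))) (ℤP.-1*i≡-i (+ suc P-1)))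
                                                  (ℤP.m-n≡m⊖n (a ℕ.* suc Q-1) (suc P-1)))
      lhs : + (k ℕ.* suc d-1) ≡ ℚᵘ.numerator ℚᵘ.∣ mkℚᵘ (+ a) P-1 ℚᵘ.- mkℚᵘ (+ 1) Q-1 ∣ ℤ.* + suc d-1
      lhs = trans (ℤP.pos-* k (suc d-1)) (cong (ℤ._* + suc d-1) (sym numerator≡))
      rhs : + (num ℕ.* (suc P-1 ℕ.* suc Q-1)) ≡ + num ℤ.* ℚᵘ.denominator ℚᵘ.∣ mkℚᵘ (+ a) P-1 ℚᵘ.- mkℚᵘ (+ 1) Q-1 ∣
      rhs = ℤP.pos-* num (suc P-1 ℕ.* suc Q-1)
      lt : k ℕ.* suc d-1 ℕ.< num ℕ.* (suc P-1 ℕ.* suc Q-1)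
      lt = ℕP.≤-<-trans (ℕP.*-monoˡ-≤ (suc d-1) (∣⊖∣≤ _ _ X aQ≤P+X P≤aQ+X)) Xd<numPQ

  ∣a/P-1/Q∣< : ∀ a P Q X num d-1 .(c : Coprime num (suc d-1)) .{{_ : NonZero P}} →
               a ℕ.* suc Q ℕ.≤ P ℕ.+ X → P ℕ.≤ a ℕ.* suc Q ℕ.+ X → X ℕ.* suc d-1 ℕ.< num ℕ.* (P ℕ.* suc Q) →
               ℚ.∣ (+ a) ℚ./ P ℚ.- (+ 1) ℚ./ suc Q ∣ ℚ.< mkℚ (+ num) d-1 c
  ∣a/P-1/Q∣< a (suc P-1) Q X num d-1 c aQ≤P+X P≤aQ+X Xd<numPQ =
    ℚP.toℚᵘ-cancel-< (ℚᵘP.<-respˡ-≃ (ℚᵘP.≃-sym toℚᵘ-∣x-y∣) (∣a/P-1/Q∣<ᵘ a P-1 Q num d-1 X aQ≤P+X P≤aQ+X Xd<numPQ))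
    where
    x = (+ a) ℚ./ suc P-1
    y = (+ 1) ℚ./ suc Q
    toℚᵘ-∣x-y∣ : toℚᵘ ℚ.∣ x ℚ.- y ∣ ℚᵘ.≃ ℚᵘ.∣ mkℚᵘ (+ a) P-1 ℚᵘ.- mkℚᵘ (+ 1) Q ∣
    toℚᵘ-∣x-y∣ = ℚᵘP.≃-trans (ℚP.toℚᵘ-homo-∣-∣ (x ℚ.- y))
                   (ℚᵘP.∣-∣-cong (ℚᵘP.≃-trans (ℚP.toℚᵘ-homo-+ x (ℚ.- y))
                     (ℚᵘP.+-cong (toℚᵘ-/ (+ a) (suc P-1))
                       (ℚᵘP.≃-trans (ℚP.toℚᵘ-homo‿- y) (ℚᵘP.-‿cong (toℚᵘ-/ (+ 1) (suc Q)))))))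

module LineCount (p : ℕ) (p-prime : Prime p) (c : ℕ) where

  open import Data.Nat
  open import Data.Nat.Properties
  open import Data.Nat.DivMod
  open import Data.Nat.Tactic.RingSolver using (solve-∀)
  open import Data.Product using (_×_; _,_; ∃-syntax)
  open import Relation.Binary.PropositionalEquality
  open PowerGrowth

  open Reachability p p-prime
  open Mixing p p-prime
  open CalkinWilfResidues p
  open Walk p

  lineCount : ℕ → ℕ
  lineCount n = ∑² (λ t → 𝟙-line c t * count n t)

  error : ℕ → ℕ → ℕ
  error r j = #punctured * (2 ^ r * surplus ^ j)

  lineCount-bounds : ∀ r j → let n = j * mixingTime + r in
    suc p * lineCount n ≤ 2 ^ n + error r j × 2 ^ n ≤ suc p * lineCount n + error r j
  lineCount-bounds r j with equidistribution r j (𝟙-line c) (𝟙-line-origin c)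
  ... | upper , lower =
    *-cancelˡ-≤ (p ∸ 1) (subst₂ _≤_ (reassoc (lineCount n)) (cong (_* (2 ^ n + error r j)) G≡p∸1) upper) ,
    *-cancelˡ-≤ (p ∸ 1) (subst₂ _≤_ (cong (_* 2 ^ n) G≡p∸1) lower-rhs lower)
    where
    instance
      p∸1≢0 : NonZero (p ∸ 1)
      p∸1≢0 = >-nonZero (m<n⇒0<n∸m 1<p)
    n = j * mixingTime + r
    G≡p∸1 : ∑² (𝟙-line c) ≡ p ∸ 1
    G≡p∸1 = trans (sym (m+n∸n≡m _ 1)) (cong (_∸ 1) (∑²-line c))
    reassoc : ∀ T → #punctured * T ≡ (p ∸ 1) * (suc p * T)
    reassoc T = trans (cong (_* T) #punctured≡[p+1][p∸1]) (trans (cong (_* T) (*-comm (suc p) (p ∸ 1))) (*-assoc (p ∸ 1) (suc p) T))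
    lower-rhs : #punctured * lineCount n + ∑² (𝟙-line c) * error r j ≡ (p ∸ 1) * (suc p * lineCount n + error r j)
    lower-rhs = trans (cong₂ _+_ (reassoc (lineCount n)) (cong (_* error r j) G≡p∸1)) (sym (*-distribˡ-+ (p ∸ 1) _ (error r j)))

  error-small : ∀ d → ∃[ J ] (∀ r j → J ≤ j → error r j * d < 2 ^ (j * mixingTime + r) * suc p)
  error-small d with *-^-<-suc-^-eventually ((p ∸ 1) * d) (2 ^ mixingTime ∸ 1)
  ... | J , small = J , λ r j J≤j → begin-strict
      #punctured * (2 ^ r * surplus ^ j) * d                  ≡⟨ cong (λ z → z * (2 ^ r * surplus ^ j) * d) #punctured≡[p+1][p∸1] ⟩
      suc p * (p ∸ 1) * (2 ^ r * surplus ^ j) * d             ≡⟨ rearrange (suc p) (p ∸ 1) (2 ^ r) (surplus ^ j) d ⟩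
      (suc p * 2 ^ r) * ((p ∸ 1) * d * surplus ^ j)           <⟨ *-monoʳ-< (suc p * 2 ^ r) {{m*n≢0 (suc p) (2 ^ r) {{_}} {{m^n≢0 2 r}}}} (≤-<-trans
                                                                   (*-monoʳ-≤ ((p ∸ 1) * d) (^-monoˡ-≤ j surplus≤2^K∸1)) (small j J≤j)) ⟩
      (suc p * 2 ^ r) * suc (2 ^ mixingTime ∸ 1) ^ j           ≡⟨ cong (λ x → (suc p * 2 ^ r) * x ^ j) (m+[n∸m]≡n (m^n>0 2 mixingTime)) ⟩
      (suc p * 2 ^ r) * (2 ^ mixingTime) ^ j                   ≡⟨ cong (suc p * 2 ^ r *_) (trans (^-*-assoc 2 mixingTime j) (cong (2 ^_) (*-comm mixingTime j))) ⟩
      (suc p * 2 ^ r) * 2 ^ (j * mixingTime)                   ≡⟨ rearrange′ (suc p) (2 ^ r) (2 ^ (j * mixingTime)) ⟩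
      2 ^ (j * mixingTime) * 2 ^ r * suc p                     ≡⟨ cong (_* suc p) (^-distribˡ-+-* 2 (j * mixingTime) r) ⟨
      2 ^ (j * mixingTime + r) * suc p                         ∎
    where
    open ≤-Reasoning
    surplus≤2^K∸1 : surplus ≤ 2 ^ mixingTime ∸ 1
    surplus≤2^K∸1 = ∸-monoʳ-≤ (2 ^ mixingTime)
      (subst (1 ≤_) (sym #punctured≡[p+1][p∸1]) (*-mono-≤ {1} {suc p} {1} {p ∸ 1} (s≤s z≤n) (∸-monoˡ-≤ 1 1<p)))
    rearrange : ∀ a b c e d → a * b * (c * e) * d ≡ (a * c) * (b * d * e)
    rearrange = solve-∀
    rearrange′ : ∀ a b c → (a * b) * c ≡ c * b * a
    rearrange′ = solve-∀

  CloseAt : ℕ → ℕ → Set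
  CloseAt d n = ∃[ X ] (suc p * lineCount n ≤ 2 ^ n + X × 2 ^ n ≤ suc p * lineCount n + X × X * d < 2 ^ n * suc p)

  lineCount-close : ∀ d → ∃[ N ] (∀ n → N ≤ n → CloseAt d n)
  lineCount-close d with error-small d
  ... | J , small = J * mixingTime , λ n JK≤n →
    subst (CloseAt d) (n≡jK+r n) (close-at (n % mixingTime) (n / mixingTime) (J≤n/K n JK≤n))
    where
    instance
      mixingTime≢0 : NonZero mixingTime
      mixingTime≢0 = >-nonZero (≤-trans 0<p (≤-trans (m≤m+n p (p + p)) (m≤m+n _ _)))
    close-at : ∀ r j → J ≤ j → CloseAt d (j * mixingTime + r)
    close-at r j J≤j with lineCount-bounds r j
    ... | upper , lower = error r j , upper , lower , small r j J≤j
    n≡jK+r : ∀ n → n / mixingTime * mixingTime + n % mixingTime ≡ n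
    n≡jK+r n = trans (+-comm _ (n % mixingTime)) (sym (m≡m%n+[m/n]*n n mixingTime))
    J≤n/K : ∀ n → J * mixingTime ≤ n → J ≤ n / mixingTime
    J≤n/K n JK≤n = subst (_≤ n / mixingTime) (m*n/n≡m J mixingTime) (/-monoˡ-≤ mixingTime JK≤n)

open import Defs
open import Data.Nat using (ℕ; suc; _≤_)
open import Data.Nat.Primality using (Prime)
open import Data.Integer using (+_)
open import Data.Rational using (ℚ; 0ℚ; _<_; _-_; ∣_∣; _/_)
open import Data.Product using (∃)

open import Data.Nat using (zero; _^_; _*_; _+_)
open import Data.Nat.Properties using (*-comm; m^n≢0; <-≤-trans; m≤n*m)
open import Data.Integer using (-[1+_]; +<+)
open import Data.Rational using (mkℚ; *<*)
open import Data.Product using (_,_; proj₁; proj₂)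
open import Relation.Binary.PropositionalEquality using (subst; sym)

theorem9 : (p : ℕ) → Prime p → (z : ℤ[ p ]) →
    (ε : ℚ) → 0ℚ < ε →
    ∃ λ N → (n : ℕ) → N ≤ n → ∣ F p z 1 n - (+ 1) / suc p ∣ < ε
theorem9 p p-prime z (mkℚ (+ zero) _ _)   (*<* (+<+ ()))
theorem9 p p-prime z (mkℚ -[1+ _ ] _ _)   (*<* ())
theorem9 p p-prime z (mkℚ (+ suc m) d-1 coprime) _ = N , λ n N≤n → close⇒<ε n (close n N≤n)
  where
  open Reachability p p-prime using (p≢0)
  open LineCount p p-prime (res z 1)
  open CalkinWilfResidues p using (length-filter-ordGe)
  open RationalBound using (∣a/P-1/Q∣<)
  N = proj₁ (lineCount-close (suc d-1))
  close = proj₂ (lineCount-close (suc d-1))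
  close⇒<ε : ∀ n → CloseAt (suc d-1) n → ∣ F p z 1 n - (+ 1) / suc p ∣ < mkℚ (+ suc m) d-1 coprime
  close⇒<ε n (X , upper , lower , small) =
    subst (λ a → ∣ ((+ a) / 2 ^ n) {{m^n≢0 2 n}} - (+ 1) / suc p ∣ < mkℚ (+ suc m) d-1 coprime) (sym (length-filter-ordGe z n))
      (∣a/P-1/Q∣< (lineCount n) (2 ^ n) p X (suc m) d-1 coprime {{m^n≢0 2 n}}
        (subst (_≤ 2 ^ n + X) (*-comm (suc p) (lineCount n)) upper)
        (subst (λ a → 2 ^ n ≤ a + X) (*-comm (suc p) (lineCount n)) lower)
        (<-≤-trans small (m≤n*m (2 ^ n * suc p) (suc m))))
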